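{- Let $p$ be a prime, $N_1,\dots,N_k$ positive integers, and $m,r,w$ non-negative integers with $0\le w<p^r$. Then $$\frac{\mathbf B_{\mathbf N}(w+mp^r)}{\mathbf B_{\mathbf N}(m)}\in\mathbb{Z}_p,$$ where $\mathbf B_{\mathbf N}(n)=\prod_{i=1}^k\mathbf B_{N_i}(n)$.
   Context: For a positive integer $N$, let $r_1,\dots,r_{\varphi(N)}$ be the integers in $\{1,\dots,N\}$ coprime to $N$, $C_N=N^{\varphi(N)}\prod_{q\mid N,\,q\text{ prime}}q^{\varphi(N)/(q-1)}$, and $\mathbf B_N(n)=C_N^n\prod_{j=1}^{\varphi(N)}\frac{(r_j/N)_n}{n!}$ (a positive integer), where $(\alpha)_n=\alpha(\alpha+1)\cdots(\alpha+n-1)$, $(\alpha)_0=1$, and $\varphi$ is Euler's totient function. $\mathbb{Z}_p$ denotes the $p$-adic integers. -}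

module Defs where

open import Data.Nat as ℕ using (ℕ; zero; suc; _^_; _∸_; _!)
open import Data.Nat.Divisibility using (_∣?_)
open import Data.Nat.Coprimality using (coprime?)
open import Data.Nat.Primality using (prime?)
open import Data.Integer using (ℤ; +_)
open import Data.Rational using (ℚ; _/_; 0ℚ; 1ℚ; _*_; _+_)
open import Data.List using (List; []; _∷_; map; filter; length; upTo; foldr)
open import Relation.Nullary.Decidable using (_×-dec_)

-- safe natural division (m / 0 := 0); only used with nonzero divisors
divℕ : ℕ → ℕ → ℕ
divℕ m zero = 0
divℕ m (suc k) = m ℕ./ suc k

-- the rational number a / b  (with a / 0 := 0; only used with b ≠ 0)
frac : ℕ → ℕ → ℚ
frac a zero = 0ℚ
frac a (suc b) = + a / suc b

ℕ→ℚ : ℕ → ℚ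
ℕ→ℚ a = + a / 1

ℤ→ℚ : ℤ → ℚ
ℤ→ℚ c = c / 1

range1 : ℕ → List ℕ
range1 N = map suc (upTo N)

coprimeResidues : ℕ → List ℕ
coprimeResidues N = filter (λ r → coprime? r N) (range1 N)

φ : ℕ → ℕ
φ N = length (coprimeResidues N)

primeDivisors : ℕ → List ℕ
primeDivisors N = filter (λ q → prime? q ×-dec (q ∣? N)) (range1 N)

productℕ : List ℕ → ℕ
productℕ = foldr ℕ._*_ 1

productℚ : List ℚ → ℚ
productℚ = foldr _*_ 1ℚ

C : ℕ → ℕ
C N = N ^ φ N ℕ.* productℕ (map (λ q → q ^ divℕ (φ N) (q ∸ 1)) (primeDivisors N))

poch : ℚ → ℕ → ℚ
poch α zero = 1ℚ
poch α (suc n) = poch α n * (α + ℕ→ℚ n)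

B : ℕ → ℕ → ℚ
B N n = ℕ→ℚ (C N ^ n) * productℚ (map (λ r → poch (frac r N) n * frac 1 (n !)) (coprimeResidues N))

BB : List ℕ → ℕ → ℚ
BB Ns n = productℚ (map (λ N → B N n) Ns)

{-# OPTIONS --safe #-}
-- Clearing denominators, B_N(n) = X_N(n) / Y_N(n) with X_N(n) = C_N^n ∏_{k ≤ nN, (k,N) = 1} k
-- and Y_N(n) = (N^n n!)^φ(N). Peeling off base-p digits of w, it suffices to show
-- vₚ(Y(ρ + qp) X(q)) ≤ vₚ(X(ρ + qp) Y(q)) for ρ < p. By Legendre, vₚ((ρ + qp)!) = q + vₚ(q!),
-- so the denominator gains p^(qφ(N)), which the numerator absorbs: if p ∤ N, multiplication
-- by p sends the qφ(N) integers ≤ qN prime to N to multiples of p that are ≤ qpN and prime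
-- to N; if p ∣ N, then (p − 1) ∣ φ(N), so p^(φ(N)/(p − 1)) divides C_N / N^φ(N), and the
-- extra factor (C_N / N^φ(N))^(ρ + q(p − 1)) supplies p^(qφ(N)).
module Submission where

open import Algebra.Bundles using (CommutativeMonoid)
import Algebra.Properties.CommutativeSemigroup
open import Data.Bool using (Bool; true; false; if_then_else_; _∧_; not)
import Data.Bool.Properties as Bool
import Data.Integer as ℤ
import Data.Integer.Properties as ℤ
open import Data.List using (List; []; _∷_; _++_; [_]; map; filter; length; upTo)
open import Data.List.Membership.Propositional using (_∈_)
open import Data.List.Membership.Propositional.Properties using (∈-map⁺; ∈-filter⁺; ∈-upTo⁺)
import Data.List.Properties as List
open import Data.List.Relation.Unary.All using (All; []; _∷_)
import Data.List.Relation.Unary.All as All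
import Data.List.Relation.Unary.All.Properties as All
open import Data.Nat
  using (ℕ; zero; suc; _+_; _*_; _^_; _∸_; _≤_; _<_; s≤s; NonZero; _!; nonTrivial⇒n>1)
open import Data.Nat.Coprimality using (Coprime; coprime?; coprime-divisor)
open import Data.Nat.Divisibility
  using ( _∣_; _∤_; _∣?_; divides; module ∣-Reasoning; ∣-refl; ∣-trans; ∣⇒≤; ∣1⇒≡1; 0∣⇒≡0
        ; ∣m+n∣m⇒∣n; ∣m∣n⇒∣m+n; ∣m⇒∣m*n; ∣n⇒∣m*n; n∣m*n; m∣m*n; *-pres-∣; *-monoʳ-∣; *-monoˡ-∣)
open import Data.Nat.DivMod using (_/_; _%_; m/n*n≡m; m%n<n; m≡m%n+[m/n]*n; m<n*o⇒m/o<n)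
open import Data.Nat.Induction using (<-rec)
open import Data.Nat.ListAction using (product)
open import Data.Nat.ListAction.Properties using (product-++; product≢0; ∈⇒∣product)
open import Data.Nat.Primality
  using (Prime; prime?; prime⇒nonZero; prime⇒nonTrivial; prime⇒irreducible; euclidsLemma)
import Data.Nat.Properties as ℕ
open import Data.Nat.Tactic.RingSolver using (solve-∀)
open import Data.Product using (_×_; _,_; ∃-syntax)
open import Data.Rational using (ℚ; toℚᵘ)
import Data.Rational as ℚ
import Data.Rational.Properties as ℚ
open import Data.Rational.Solver using (module +-*-Solver)
open import Data.Rational.Unnormalised using (mkℚᵘ; *≡*) renaming (_≃_ to _≃ᵘ_)
import Data.Rational.Unnormalised as ℚᵘ
import Data.Rational.Unnormalised.Properties as ℚᵘ
open import Data.Sum using (inj₁; inj₂; [_,_]′)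
open import Function using (_∘_; id; mk⇔)
open import Level using (0ℓ)
open import Relation.Binary.Bundles using (Preorder)
open import Relation.Binary.PropositionalEquality hiding ([_])
import Relation.Binary.Reasoning.Preorder
open import Relation.Binary.Structures using (IsPreorder)
open import Relation.Nullary using (Dec; does; yes; no; ¬_; ¬?; contradiction)
open import Relation.Nullary.Decidable using (dec-true; dec-false; does-⇔; _×-dec_)
open import Relation.Unary using (Pred; Decidable)

open import Defs

open +-*-Solver using (solve; _:+_; _:*_; _:=_)
module ℕ+ = Algebra.Properties.CommutativeSemigroup ℕ.+-commutativeSemigroup
module ℕ* = Algebra.Properties.CommutativeSemigroup ℕ.*-commutativeSemigroup
module ℚ* = Algebra.Properties.CommutativeSemigroup
  (CommutativeMonoid.commutativeSemigroup ℚ.*-1-commutativeMonoid)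

*-^-distrib : ∀ m n o → (m * n) ^ o ≡ m ^ o * n ^ o
*-^-distrib m n zero    = refl
*-^-distrib m n (suc o) rewrite *-^-distrib m n o = ℕ.[m*n]*[o*p]≡[m*o]*[n*p] m n (m ^ o) (n ^ o)

^-pres-∣ : ∀ {m n} o → m ∣ n → m ^ o ∣ n ^ o
^-pres-∣ zero    m∣n = ∣-refl
^-pres-∣ (suc o) m∣n = *-pres-∣ m∣n (^-pres-∣ o m∣n)

^-∣-^ : ∀ m {n o} → n ≤ o → m ^ n ∣ m ^ o
^-∣-^ m {n} {o} n≤o = divides (m ^ (o ∸ n)) (begin
  m ^ o                   ≡⟨ cong (m ^_) (ℕ.m+[n∸m]≡n n≤o) ⟨
  m ^ (n + (o ∸ n))       ≡⟨ ℕ.^-distribˡ-+-* m n (o ∸ n) ⟩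
  m ^ n * m ^ (o ∸ n)     ≡⟨ ℕ.*-comm (m ^ n) (m ^ (o ∸ n)) ⟩
  m ^ (o ∸ n) * m ^ n     ∎)
  where open ≡-Reasoning

divℕ-* : ∀ m n → n ∣ m → divℕ m n * n ≡ m
divℕ-* m zero    0∣m = sym (0∣⇒≡0 0∣m)
divℕ-* m (suc n) n∣m = m/n*n≡m n∣m

+-! : ∀ m .{{_ : NonZero m}} n → (m + n) ! ≡ (m + n) * ((m ∸ 1) + n) !
+-! (suc m) n = refl

product-map-* : ∀ {A : Set} (f g : A → ℕ) xs →
  product (map (λ x → f x * g x) xs) ≡ product (map f xs) * product (map g xs)
product-map-* f g []       = refl
product-map-* f g (x ∷ xs) rewrite product-map-* f g xs =
  ℕ.[m*n]*[o*p]≡[m*o]*[n*p] (f x) (g x) (product (map f xs)) (product (map g xs))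

product-map-const : ∀ {A : Set} k (xs : List A) → product (map (λ _ → k) xs) ≡ k ^ length xs
product-map-const k []       = refl
product-map-const k (x ∷ xs) = cong (k *_) (product-map-const k xs)

-- count and productWhere range over k ∈ {1, …, x}, like range1 x.
count : (ℕ → Bool) → ℕ → ℕ
count P zero    = 0
count P (suc x) = count P x + (if P (suc x) then 1 else 0)

productWhere : (ℕ → Bool) → (ℕ → ℕ) → ℕ → ℕ
productWhere P f zero    = 1
productWhere P f (suc x) = productWhere P f x * (if P (suc x) then f (suc x) else 1)

count-cong : ∀ {P Q} → (∀ k → P k ≡ Q k) → ∀ x → count P x ≡ count Q x
count-cong P≗Q zero = refl
count-cong P≗Q (suc x) rewrite P≗Q (suc x) = cong (_+ _) (count-cong P≗Q x)

productWhere-cong : ∀ {P Q f g} → (∀ k → P k ≡ Q k) → (∀ k → f k ≡ g k) →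
                    ∀ x → productWhere P f x ≡ productWhere Q g x
productWhere-cong P≗Q f≗g zero = refl
productWhere-cong P≗Q f≗g (suc x) rewrite P≗Q (suc x) | f≗g (suc x) =
  cong (_* _) (productWhere-cong P≗Q f≗g x)

count-+ : ∀ P a b → count P (a + b) ≡ count P a + count (λ k → P (a + k)) b
count-+ P a zero rewrite ℕ.+-identityʳ a = sym (ℕ.+-identityʳ _)
count-+ P a (suc b) rewrite ℕ.+-suc a b | count-+ P a b = ℕ.+-assoc (count P a) _ _

productWhere-+ : ∀ P f a b → productWhere P f (a + b) ≡
                 productWhere P f a * productWhere (λ k → P (a + k)) (λ k → f (a + k)) b
productWhere-+ P f a zero rewrite ℕ.+-identityʳ a = sym (ℕ.*-identityʳ _)
productWhere-+ P f a (suc b) rewrite ℕ.+-suc a b | productWhere-+ P f a b =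
  ℕ.*-assoc (productWhere P f a) _ _

indicator-∧-split : ∀ b c → (if b then 1 else 0) ≡ (if b ∧ c then 1 else 0) + (if b ∧ not c then 1 else 0)
indicator-∧-split true  true  = refl
indicator-∧-split true  false = refl
indicator-∧-split false c     = refl

count-∧-split : ∀ (P A : ℕ → Bool) x → count P x ≡ count (λ k → P k ∧ A k) x + count (λ k → P k ∧ not (A k)) x
count-∧-split P A zero = refl
count-∧-split P A (suc x) =
  trans (cong₂ _+_ (count-∧-split P A x) (indicator-∧-split (P (suc x)) (A (suc x))))
        (ℕ+.interchange (count (λ k → P k ∧ A k) x) (count (λ k → P k ∧ not (A k)) x) _ _)

count-false : ∀ (P : ℕ → Bool) x → (∀ k → k < x → P (suc k) ≡ false) → count P x ≡ 0
count-false P zero    _      = refl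
count-false P (suc x) P≡false
  rewrite P≡false x ℕ.≤-refl | count-false P x (λ k k<x → P≡false k (ℕ.m≤n⇒m≤1+n k<x)) = refl

count-∧-multiples : ∀ (P : ℕ → Bool) t .{{_ : NonZero t}} y →
  count (λ k → P k ∧ does (t ∣? k)) (y * t) ≡ count (λ j → P (j * t)) y
count-∧-multiples P t zero = refl
count-∧-multiples P t@(suc s) (suc y) = begin
  count R (t + y * t)                                       ≡⟨ cong (count R) (ℕ.+-comm t (y * t)) ⟩
  count R (y * t + t)                                       ≡⟨ count-+ R (y * t) t ⟩
  count R (y * t) + (count R′ s + (if R′ t then 1 else 0))
    ≡⟨ cong₂ (λ a b → a + (b + (if R′ t then 1 else 0))) (count-∧-multiples P t y) (count-false R′ s between) ⟩
  count (λ j → P (j * t)) y + (if R′ t then 1 else 0)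
    ≡⟨ cong (λ b → count (λ j → P (j * t)) y + (if b then 1 else 0)) last ⟩
  count (λ j → P (j * t)) y + (if P (suc y * t) then 1 else 0) ∎
  where
  open ≡-Reasoning
  R R′ : ℕ → Bool
  R k = P k ∧ does (t ∣? k)
  R′ k = R (y * t + k)
  t∤ : ∀ k → k < s → t ∤ y * t + suc k
  t∤ k k<s t∣ = ℕ.<⇒≱ (s≤s k<s) (∣⇒≤ (∣m+n∣m⇒∣n t∣ (n∣m*n y)))
  between : ∀ k → k < s → R′ (suc k) ≡ false
  between k k<s rewrite dec-false (t ∣? (y * t + suc k)) (t∤ k k<s) = Bool.∧-zeroʳ _
  last : R′ t ≡ P (suc y * t)
  last rewrite ℕ.+-comm (y * t) t | dec-true (t ∣? (t + y * t)) (n∣m*n (suc y)) = Bool.∧-identityʳ _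

module _ {P : Pred ℕ 0ℓ} (P? : Decidable P) where

  filter-range1-suc : ∀ x → filter P? (range1 (suc x)) ≡ filter P? (range1 x) ++ filter P? [ suc x ]
  filter-range1-suc x = begin
    filter P? (map suc (upTo (suc x)))         ≡⟨ cong (filter P? ∘ map suc) (List.upTo-∷ʳ x) ⟨
    filter P? (map suc (upTo x ++ [ x ]))      ≡⟨ cong (filter P?) (List.map-++ suc (upTo x) [ x ]) ⟩
    filter P? (map suc (upTo x) ++ [ suc x ])  ≡⟨ List.filter-++ P? (map suc (upTo x)) [ suc x ] ⟩
    filter P? (range1 x) ++ filter P? [ suc x ] ∎
    where open ≡-Reasoning

  length-filter-range1 : ∀ x → length (filter P? (range1 x)) ≡ count (does ∘ P?) x
  length-filter-range1 zero = refl
  length-filter-range1 (suc x)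
    rewrite filter-range1-suc x | List.length-++ (filter P? (range1 x)) {filter P? [ suc x ]}
          | length-filter-range1 x with P? (suc x)
  ... | yes _ = refl
  ... | no  _ = refl

  product-filter-range1 : ∀ f x → product (map f (filter P? (range1 x))) ≡ productWhere (does ∘ P?) f x
  product-filter-range1 f zero = refl
  product-filter-range1 f (suc x)
    rewrite filter-range1-suc x | List.map-++ f (filter P? (range1 x)) (filter P? [ suc x ])
          | product-++ (map f (filter P? (range1 x))) (map f (filter P? [ suc x ]))
          | product-filter-range1 f x with P? (suc x)
  ... | yes _ = cong (productWhere (does ∘ P?) f x *_) (ℕ.*-identityʳ (f (suc x)))
  ... | no  _ = refl

coprimeTo : ℕ → ℕ → Bool
coprimeTo N k = does (coprime? k N)

φ≡count-coprimeTo : ∀ N → φ N ≡ count (coprimeTo N) N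
φ≡count-coprimeTo N = length-filter-range1 (λ k → coprime? k N) N

coprimeTo-+-multiple : ∀ {N M} k → N ∣ M → coprimeTo N (M + k) ≡ coprimeTo N k
coprimeTo-+-multiple {N} {M} k N∣M = does-⇔ (mk⇔
  (λ c {d} (d∣k , d∣N) → c (∣m∣n⇒∣m+n (∣-trans d∣N N∣M) d∣k , d∣N))
  (λ c {d} (d∣M+k , d∣N) → c (∣m+n∣m⇒∣n d∣M+k (∣-trans d∣N N∣M) , d∣N)))
  (coprime? (M + k) N) (coprime? k N)

coprimeTo-*-coprime : ∀ {N t} k → Coprime t N → coprimeTo N (k * t) ≡ coprimeTo N k
coprimeTo-*-coprime {N} {t} k t⊥N = does-⇔ (mk⇔
  (λ c {d} (d∣k , d∣N) → c (∣m⇒∣m*n t d∣k , d∣N))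
  (λ c {d} (d∣kt , d∣N) → c (coprime-divisor (d⊥t d∣N) (subst (d ∣_) (ℕ.*-comm k t) d∣kt) , d∣N)))
  (coprime? (k * t) N) (coprime? k N)
  where
  d⊥t : ∀ {d} → d ∣ N → Coprime d t
  d⊥t d∣N (e∣d , e∣t) = t⊥N (e∣t , ∣-trans e∣d d∣N)

count-coprimeTo-multiple : ∀ N q → count (coprimeTo N) (q * N) ≡ q * φ N
count-coprimeTo-multiple N zero = refl
count-coprimeTo-multiple N (suc q) = begin
  count (coprimeTo N) (N + q * N)                                  ≡⟨ cong (count (coprimeTo N)) (ℕ.+-comm N (q * N)) ⟩
  count (coprimeTo N) (q * N + N)                                  ≡⟨ count-+ (coprimeTo N) (q * N) N ⟩
  count (coprimeTo N) (q * N) + count (λ k → coprimeTo N (q * N + k)) N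
    ≡⟨ cong₂ _+_ (count-coprimeTo-multiple N q) (count-cong (λ k → coprimeTo-+-multiple k (n∣m*n q)) N) ⟩
  q * φ N + count (coprimeTo N) N                                  ≡⟨ cong (q * φ N +_) (φ≡count-coprimeTo N) ⟨
  q * φ N + φ N                                                    ≡⟨ ℕ.+-comm (q * φ N) (φ N) ⟩
  suc q * φ N                                                      ∎
  where open ≡-Reasoning

coprimeFactorial : ℕ → ℕ → ℕ
coprimeFactorial N = productWhere (coprimeTo N) id

coprimeFactorial-∣-+ : ∀ N x z → coprimeFactorial N x ∣ coprimeFactorial N (x + z)
coprimeFactorial-∣-+ N x z =
  subst (coprimeFactorial N x ∣_) (sym (productWhere-+ (coprimeTo N) id x z)) (m∣m*n _)

^-indicator-step : ∀ b t c q m →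
  t ^ (c + (if b then 1 else 0)) * (q * (if b then m else 1)) ≡ t ^ c * q * (if b then m * t else 1)
^-indicator-step false t c q m
  rewrite ℕ.+-identityʳ c | ℕ.*-identityʳ q = sym (ℕ.*-identityʳ (t ^ c * q))
^-indicator-step true t c q m rewrite ℕ.^-distribˡ-+-* t c 1 = rearrange (t ^ c) t q m
  where
  rearrange : ∀ x t q m → x * (t * 1) * (q * m) ≡ x * q * (m * t)
  rearrange = solve-∀

-- Multiplication by t maps the k ≤ y coprime to N into the multiples of t up to y t coprime to N.
coprimeFactorial-lift : ∀ {N} t .{{_ : NonZero t}} → Coprime t N → ∀ y →
  t ^ count (coprimeTo N) y * coprimeFactorial N y ∣ coprimeFactorial N (y * t)
coprimeFactorial-lift t t⊥N zero = ∣-refl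
coprimeFactorial-lift {N} t@(suc s) t⊥N (suc y) =
  subst₂ _∣_ (sym (^-indicator-step b t (count (coprimeTo N) y) (coprimeFactorial N y) (suc y))) (sym window)
    (*-pres-∣ (coprimeFactorial-lift t t⊥N y) (n∣m*n (productWhere shifted (y * t +_) s)))
  where
  b = coprimeTo N (suc y)
  shifted : ℕ → Bool
  shifted k = coprimeTo N (y * t + k)
  last : (if shifted t then y * t + t else 1) ≡ (if b then suc y * t else 1)
  last rewrite ℕ.+-comm (y * t) t | coprimeTo-*-coprime (suc y) t⊥N = refl
  window : coprimeFactorial N (suc y * t) ≡
           coprimeFactorial N (y * t) * (productWhere shifted (y * t +_) s * (if b then suc y * t else 1))
  window = begin
    coprimeFactorial N (suc y * t)  ≡⟨ cong (coprimeFactorial N) (ℕ.+-comm t (y * t)) ⟩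
    coprimeFactorial N (y * t + t)  ≡⟨ productWhere-+ (coprimeTo N) id (y * t) t ⟩
    coprimeFactorial N (y * t) * (productWhere shifted (y * t +_) s * (if shifted t then y * t + t else 1))
      ≡⟨ cong (λ z → coprimeFactorial N (y * t) * (productWhere shifted (y * t +_) s * z)) last ⟩
    coprimeFactorial N (y * t) * (productWhere shifted (y * t +_) s * (if b then suc y * t else 1)) ∎
    where open ≡-Reasoning

-- scaledPoch N r n = N ^ n * (r / N)ₙ
scaledPoch : ℕ → ℕ → ℕ → ℕ
scaledPoch N r zero    = 1
scaledPoch N r (suc n) = scaledPoch N r n * (r + n * N)

product-scaledPoch : ∀ N n →
  product (map (λ r → scaledPoch N r n) (coprimeResidues N)) ≡ coprimeFactorial N (n * N)
product-scaledPoch N zero = trans (product-map-const 1 (coprimeResidues N)) (ℕ.^-zeroˡ (φ N))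
product-scaledPoch N (suc n) = begin
  product (map (λ r → scaledPoch N r n * (r + n * N)) (coprimeResidues N))
    ≡⟨ product-map-* (λ r → scaledPoch N r n) (_+ n * N) (coprimeResidues N) ⟩
  product (map (λ r → scaledPoch N r n) (coprimeResidues N)) * product (map (_+ n * N) (coprimeResidues N))
    ≡⟨ cong₂ _*_ (product-scaledPoch N n) (product-filter-range1 (λ k → coprime? k N) (_+ n * N) N) ⟩
  coprimeFactorial N (n * N) * productWhere (coprimeTo N) (_+ n * N) N
    ≡⟨ cong (coprimeFactorial N (n * N) *_)
            (productWhere-cong (λ k → sym (coprimeTo-+-multiple k (n∣m*n n))) (λ k → ℕ.+-comm k (n * N)) N) ⟩
  coprimeFactorial N (n * N) * productWhere (λ k → coprimeTo N (n * N + k)) (n * N +_) N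
    ≡⟨ productWhere-+ (coprimeTo N) id (n * N) N ⟨
  coprimeFactorial N (n * N + N)  ≡⟨ cong (coprimeFactorial N) (ℕ.+-comm (n * N) N) ⟩
  coprimeFactorial N (suc n * N)  ∎
  where open ≡-Reasoning

B-numerator B-denominator : ℕ → ℕ → ℕ
B-numerator   N n = C N ^ n * coprimeFactorial N (n * N)
B-denominator N n = (N ^ n * n !) ^ φ N

-- C N ≡ N ^ φ N * primePowers N holds by definition.
primePowers : ℕ → ℕ
primePowers N = product (map (λ q → q ^ divℕ (φ N) (q ∸ 1)) (primeDivisors N))

reducedNumerator : ℕ → ℕ → ℕ
reducedNumerator N n = primePowers N ^ n * coprimeFactorial N (n * N)

B-numerator-split : ∀ N n → B-numerator N n ≡ (N ^ φ N) ^ n * reducedNumerator N n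
B-numerator-split N n = trans (cong (_* coprimeFactorial N (n * N)) (*-^-distrib (N ^ φ N) (primePowers N) n))
                              (ℕ.*-assoc ((N ^ φ N) ^ n) (primePowers N ^ n) (coprimeFactorial N (n * N)))

B-denominator-split : ∀ N n → B-denominator N n ≡ (N ^ φ N) ^ n * (n !) ^ φ N
B-denominator-split N n = begin
  (N ^ n * n !) ^ φ N             ≡⟨ *-^-distrib (N ^ n) (n !) (φ N) ⟩
  (N ^ n) ^ φ N * (n !) ^ φ N     ≡⟨ cong (_* (n !) ^ φ N) (ℕ.^-*-assoc N n (φ N)) ⟩
  N ^ (n * φ N) * (n !) ^ φ N     ≡⟨ cong (λ e → N ^ e * (n !) ^ φ N) (ℕ.*-comm n (φ N)) ⟩
  N ^ (φ N * n) * (n !) ^ φ N     ≡⟨ cong (_* (n !) ^ φ N) (ℕ.^-*-assoc N (φ N) n) ⟨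
  (N ^ φ N) ^ n * (n !) ^ φ N     ∎
  where open ≡-Reasoning

toℚᵘ-ℕ→ℚ : ∀ a → toℚᵘ (ℕ→ℚ a) ≃ᵘ mkℚᵘ (ℤ.+ a) 0
toℚᵘ-ℕ→ℚ a = ℚ.toℚᵘ-fromℚᵘ (mkℚᵘ (ℤ.+ a) 0)

toℚᵘ-frac : ∀ a b → toℚᵘ (frac a (suc b)) ≃ᵘ mkℚᵘ (ℤ.+ a) b
toℚᵘ-frac a b = ℚ.toℚᵘ-fromℚᵘ (mkℚᵘ (ℤ.+ a) b)

ℕ→ℚ-* : ∀ a b → ℕ→ℚ (a * b) ≡ ℕ→ℚ a ℚ.* ℕ→ℚ b
ℕ→ℚ-* a b = ℚ.toℚᵘ-injective (begin
  toℚᵘ (ℕ→ℚ (a * b))                  ≈⟨ toℚᵘ-ℕ→ℚ (a * b) ⟩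
  mkℚᵘ (ℤ.+ (a * b)) 0                ≈⟨ *≡* (cong (ℤ._* ℤ.1ℤ) (ℤ.pos-* a b)) ⟩
  mkℚᵘ (ℤ.+ a) 0 ℚᵘ.* mkℚᵘ (ℤ.+ b) 0  ≈⟨ ℚᵘ.*-cong (toℚᵘ-ℕ→ℚ a) (toℚᵘ-ℕ→ℚ b) ⟨
  toℚᵘ (ℕ→ℚ a) ℚᵘ.* toℚᵘ (ℕ→ℚ b)      ≈⟨ ℚ.toℚᵘ-homo-* (ℕ→ℚ a) (ℕ→ℚ b) ⟨
  toℚᵘ (ℕ→ℚ a ℚ.* ℕ→ℚ b)              ∎)
  where open ℚᵘ.≃-Reasoning

ℕ→ℚ-+ : ∀ a b → ℕ→ℚ (a + b) ≡ ℕ→ℚ a ℚ.+ ℕ→ℚ b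
ℕ→ℚ-+ a b = ℚ.toℚᵘ-injective (begin
  toℚᵘ (ℕ→ℚ (a + b))                  ≈⟨ toℚᵘ-ℕ→ℚ (a + b) ⟩
  mkℚᵘ (ℤ.+ (a + b)) 0                ≈⟨ *≡* (cong (ℤ._* ℤ.1ℤ) sums) ⟩
  mkℚᵘ (ℤ.+ a) 0 ℚᵘ.+ mkℚᵘ (ℤ.+ b) 0  ≈⟨ ℚᵘ.+-cong (toℚᵘ-ℕ→ℚ a) (toℚᵘ-ℕ→ℚ b) ⟨
  toℚᵘ (ℕ→ℚ a) ℚᵘ.+ toℚᵘ (ℕ→ℚ b)      ≈⟨ ℚ.toℚᵘ-homo-+ (ℕ→ℚ a) (ℕ→ℚ b) ⟨
  toℚᵘ (ℕ→ℚ a ℚ.+ ℕ→ℚ b)              ∎)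
  where
  open ℚᵘ.≃-Reasoning
  sums : ℤ.+ (a + b) ≡ ℤ.+ a ℤ.* ℤ.1ℤ ℤ.+ ℤ.+ b ℤ.* ℤ.1ℤ
  sums rewrite ℤ.*-identityʳ (ℤ.+ a) | ℤ.*-identityʳ (ℤ.+ b) = ℤ.pos-+ a b

frac-*-denominator : ∀ a m .{{_ : NonZero m}} → frac a m ℚ.* ℕ→ℚ m ≡ ℕ→ℚ a
frac-*-denominator a (suc b) = ℚ.toℚᵘ-injective (begin
  toℚᵘ (frac a (suc b) ℚ.* ℕ→ℚ (suc b))         ≈⟨ ℚ.toℚᵘ-homo-* (frac a (suc b)) (ℕ→ℚ (suc b)) ⟩
  toℚᵘ (frac a (suc b)) ℚᵘ.* toℚᵘ (ℕ→ℚ (suc b)) ≈⟨ ℚᵘ.*-cong (toℚᵘ-frac a b) (toℚᵘ-ℕ→ℚ (suc b)) ⟩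
  mkℚᵘ (ℤ.+ a) b ℚᵘ.* mkℚᵘ (ℤ.+ suc b) 0       ≈⟨ *≡* cross ⟩
  mkℚᵘ (ℤ.+ a) 0                                ≈⟨ toℚᵘ-ℕ→ℚ a ⟨
  toℚᵘ (ℕ→ℚ a)                                  ∎)
  where
  open ℚᵘ.≃-Reasoning
  cross : (ℤ.+ a ℤ.* ℤ.+ suc b) ℤ.* ℤ.1ℤ ≡ ℤ.+ a ℤ.* ℤ.+ suc (b * 1)
  cross rewrite ℤ.*-identityʳ (ℤ.+ a ℤ.* ℤ.+ suc b) | ℕ.*-identityʳ b = refl

ℕ→ℚ-*-cancelʳ : ∀ {x y} m .{{_ : NonZero m}} → x ℚ.* ℕ→ℚ m ≡ y ℚ.* ℕ→ℚ m → x ≡ y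
ℕ→ℚ-*-cancelʳ {x} {y} m xm≡ym = begin
  x                                  ≡⟨ ℚ.*-identityʳ x ⟨
  x ℚ.* ℚ.1ℚ                         ≡⟨ cong (x ℚ.*_) m*1/m ⟨
  x ℚ.* (ℕ→ℚ m ℚ.* frac 1 m)         ≡⟨ ℚ.*-assoc x (ℕ→ℚ m) (frac 1 m) ⟨
  x ℚ.* ℕ→ℚ m ℚ.* frac 1 m           ≡⟨ cong (ℚ._* frac 1 m) xm≡ym ⟩
  y ℚ.* ℕ→ℚ m ℚ.* frac 1 m           ≡⟨ ℚ.*-assoc y (ℕ→ℚ m) (frac 1 m) ⟩
  y ℚ.* (ℕ→ℚ m ℚ.* frac 1 m)         ≡⟨ cong (y ℚ.*_) m*1/m ⟩
  y ℚ.* ℚ.1ℚ                         ≡⟨ ℚ.*-identityʳ y ⟩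
  y                                  ∎
  where
  open ≡-Reasoning
  m*1/m : ℕ→ℚ m ℚ.* frac 1 m ≡ ℚ.1ℚ
  m*1/m = trans (ℚ.*-comm (ℕ→ℚ m) (frac 1 m)) (frac-*-denominator 1 m)

poch-*-scale : ∀ N .{{_ : NonZero N}} r n → poch (frac r N) n ℚ.* ℕ→ℚ (N ^ n) ≡ ℕ→ℚ (scaledPoch N r n)
poch-*-scale N r zero    = ℚ.*-identityˡ (ℕ→ℚ 1)
poch-*-scale N r (suc n) = begin
  P ℚ.* (x ℚ.+ n′) ℚ.* ℕ→ℚ (N * N ^ n)        ≡⟨ cong (P ℚ.* (x ℚ.+ n′) ℚ.*_) (ℕ→ℚ-* N (N ^ n)) ⟩
  P ℚ.* (x ℚ.+ n′) ℚ.* (N′ ℚ.* ℕ→ℚ (N ^ n))   ≡⟨ rearrange P x n′ N′ (ℕ→ℚ (N ^ n)) ⟩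
  P ℚ.* ℕ→ℚ (N ^ n) ℚ.* (x ℚ.* N′ ℚ.+ n′ ℚ.* N′)
    ≡⟨ cong₂ (λ a b → a ℚ.* (b ℚ.+ n′ ℚ.* N′)) (poch-*-scale N r n) (frac-*-denominator r N) ⟩
  ℕ→ℚ (scaledPoch N r n) ℚ.* (ℕ→ℚ r ℚ.+ n′ ℚ.* N′)
    ≡⟨ cong (λ z → ℕ→ℚ (scaledPoch N r n) ℚ.* (ℕ→ℚ r ℚ.+ z)) (ℕ→ℚ-* n N) ⟨
  ℕ→ℚ (scaledPoch N r n) ℚ.* (ℕ→ℚ r ℚ.+ ℕ→ℚ (n * N))
    ≡⟨ cong (ℕ→ℚ (scaledPoch N r n) ℚ.*_) (ℕ→ℚ-+ r (n * N)) ⟨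
  ℕ→ℚ (scaledPoch N r n) ℚ.* ℕ→ℚ (r + n * N)  ≡⟨ ℕ→ℚ-* (scaledPoch N r n) (r + n * N) ⟨
  ℕ→ℚ (scaledPoch N r (suc n))                ∎
  where
  open ≡-Reasoning
  P = poch (frac r N) n
  x = frac r N
  n′ = ℕ→ℚ n
  N′ = ℕ→ℚ N
  rearrange : ∀ P x n N K → P ℚ.* (x ℚ.+ n) ℚ.* (N ℚ.* K) ≡ P ℚ.* K ℚ.* (x ℚ.* N ℚ.+ n ℚ.* N)
  rearrange = solve 5 (λ P x n N K → P :* (x :+ n) :* (N :* K) := P :* K :* (x :* N :+ n :* N)) refl

pochTerm-*-scale : ∀ N .{{_ : NonZero N}} r n →
  poch (frac r N) n ℚ.* frac 1 (n !) ℚ.* ℕ→ℚ (N ^ n * n !) ≡ ℕ→ℚ (scaledPoch N r n)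
pochTerm-*-scale N r n = begin
  P ℚ.* F ℚ.* ℕ→ℚ (N ^ n * n !)               ≡⟨ cong (P ℚ.* F ℚ.*_) (ℕ→ℚ-* (N ^ n) (n !)) ⟩
  P ℚ.* F ℚ.* (ℕ→ℚ (N ^ n) ℚ.* ℕ→ℚ (n !))     ≡⟨ ℚ*.interchange P F (ℕ→ℚ (N ^ n)) (ℕ→ℚ (n !)) ⟩
  P ℚ.* ℕ→ℚ (N ^ n) ℚ.* (F ℚ.* ℕ→ℚ (n !))
    ≡⟨ cong₂ ℚ._*_ (poch-*-scale N r n) (frac-*-denominator 1 (n !) {{n ℕ.!≢0}}) ⟩
  ℕ→ℚ (scaledPoch N r n) ℚ.* ℚ.1ℚ             ≡⟨ ℚ.*-identityʳ _ ⟩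
  ℕ→ℚ (scaledPoch N r n)                      ∎
  where
  open ≡-Reasoning
  P = poch (frac r N) n
  F = frac 1 (n !)

productℚ-*-ℕ→ℚ : ∀ {A : Set} (f : A → ℚ) (g h : A → ℕ) {xs} →
  All (λ x → f x ℚ.* ℕ→ℚ (g x) ≡ ℕ→ℚ (h x)) xs →
  productℚ (map f xs) ℚ.* ℕ→ℚ (product (map g xs)) ≡ ℕ→ℚ (product (map h xs))
productℚ-*-ℕ→ℚ f g h []                   = ℚ.*-identityˡ (ℕ→ℚ 1)
productℚ-*-ℕ→ℚ f g h {x ∷ xs} (fg≡h ∷ fgs≡hs) = begin
  f x ℚ.* productℚ (map f xs) ℚ.* ℕ→ℚ (g x * product (map g xs))
    ≡⟨ cong (f x ℚ.* productℚ (map f xs) ℚ.*_) (ℕ→ℚ-* (g x) _) ⟩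
  f x ℚ.* productℚ (map f xs) ℚ.* (ℕ→ℚ (g x) ℚ.* ℕ→ℚ (product (map g xs)))
    ≡⟨ ℚ*.interchange (f x) _ _ _ ⟩
  f x ℚ.* ℕ→ℚ (g x) ℚ.* (productℚ (map f xs) ℚ.* ℕ→ℚ (product (map g xs)))
    ≡⟨ cong₂ ℚ._*_ fg≡h (productℚ-*-ℕ→ℚ f g h fgs≡hs) ⟩
  ℕ→ℚ (h x) ℚ.* ℕ→ℚ (product (map h xs))    ≡⟨ ℕ→ℚ-* (h x) _ ⟨
  ℕ→ℚ (h x * product (map h xs))            ∎
  where open ≡-Reasoning

B-*-denominator : ∀ N .{{_ : NonZero N}} n → B N n ℚ.* ℕ→ℚ (B-denominator N n) ≡ ℕ→ℚ (B-numerator N n)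
B-*-denominator N n = begin
  ℕ→ℚ (C N ^ n) ℚ.* Terms ℚ.* ℕ→ℚ (B-denominator N n)
    ≡⟨ ℚ.*-assoc (ℕ→ℚ (C N ^ n)) Terms _ ⟩
  ℕ→ℚ (C N ^ n) ℚ.* (Terms ℚ.* ℕ→ℚ ((N ^ n * n !) ^ φ N))
    ≡⟨ cong (λ z → ℕ→ℚ (C N ^ n) ℚ.* (Terms ℚ.* ℕ→ℚ z)) (product-map-const (N ^ n * n !) (coprimeResidues N)) ⟨
  ℕ→ℚ (C N ^ n) ℚ.* (Terms ℚ.* ℕ→ℚ (product (map (λ _ → N ^ n * n !) (coprimeResidues N))))
    ≡⟨ cong (ℕ→ℚ (C N ^ n) ℚ.*_)
            (productℚ-*-ℕ→ℚ (λ r → poch (frac r N) n ℚ.* frac 1 (n !)) (λ _ → N ^ n * n !) (λ r → scaledPoch N r n)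
                            (All.universal (λ r → pochTerm-*-scale N r n) (coprimeResidues N))) ⟩
  ℕ→ℚ (C N ^ n) ℚ.* ℕ→ℚ (product (map (λ r → scaledPoch N r n) (coprimeResidues N)))
    ≡⟨ cong (λ z → ℕ→ℚ (C N ^ n) ℚ.* ℕ→ℚ z) (product-scaledPoch N n) ⟩
  ℕ→ℚ (C N ^ n) ℚ.* ℕ→ℚ (coprimeFactorial N (n * N))
    ≡⟨ ℕ→ℚ-* (C N ^ n) _ ⟨
  ℕ→ℚ (B-numerator N n) ∎
  where
  open ≡-Reasoning
  Terms = productℚ (map (λ r → poch (frac r N) n ℚ.* frac 1 (n !)) (coprimeResidues N))

BB-numerator BB-denominator : List ℕ → ℕ → ℕ
BB-numerator   Ns n = product (map (λ N → B-numerator N n) Ns)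
BB-denominator Ns n = product (map (λ N → B-denominator N n) Ns)

BB-*-denominator : ∀ {Ns} → All NonZero Ns → ∀ n → BB Ns n ℚ.* ℕ→ℚ (BB-denominator Ns n) ≡ ℕ→ℚ (BB-numerator Ns n)
BB-*-denominator Ns≢0 n = productℚ-*-ℕ→ℚ (λ N → B N n) (λ N → B-denominator N n) (λ N → B-numerator N n)
  (All.map (λ N≢0 → B-*-denominator _ {{N≢0}} n) Ns≢0)

BB-denominator≢0 : ∀ {Ns} → All NonZero Ns → ∀ n → NonZero (BB-denominator Ns n)
BB-denominator≢0 Ns≢0 n = product≢0 (All.map⁺ (All.map B-denominator≢0 Ns≢0))
  where
  B-denominator≢0 : ∀ {N} → NonZero N → NonZero (B-denominator N n)
  B-denominator≢0 {N} N≢0 = ℕ.m^n≢0 (N ^ n * n !) (φ N) {{ℕ.m*n≢0 (N ^ n) (n !) {{ℕ.m^n≢0 N n {{N≢0}}}} {{n ℕ.!≢0}}}}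

module _ (p : ℕ) (p-prime : Prime p) where

  instance
    p≢0 : NonZero p
    p≢0 = prime⇒nonZero p-prime

  1<p : 1 < p
  1<p = nonTrivial⇒n>1 p {{prime⇒nonTrivial p-prime}}

  p∤1 : p ∤ 1
  p∤1 p∣1 = ℕ.<⇒≢ 1<p (sym (∣1⇒≡1 p∣1))

  ∤-* : ∀ {m n} → p ∤ m → p ∤ n → p ∤ m * n
  ∤-* p∤m p∤n p∣mn = [ p∤m , p∤n ]′ (euclidsLemma _ _ p-prime p∣mn)

  ∤⇒coprime : ∀ {n} → p ∤ n → Coprime p n
  ∤⇒coprime p∤n (d∣p , d∣n) with prime⇒irreducible p-prime d∣p
  ... | inj₁ d≡1  = d≡1
  ... | inj₂ refl = contradiction d∣n p∤n

  ∤-+-multiple : ∀ q {k} → suc k < p → p ∤ suc k + q * p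
  ∤-+-multiple q k<p p∣ = ℕ.<⇒≱ k<p (∣⇒≤ (∣m+n∣m⇒∣n (subst (p ∣_) (ℕ.+-comm (suc _) (q * p)) p∣) (n∣m*n q)))

  -- m ∣ₚ n: m divides n up to a factor prime to p, i.e. vₚ(m) ≤ vₚ(n) when n ≢ 0.
  infix 4 _∣ₚ_
  record _∣ₚ_ (m n : ℕ) : Set where
    constructor mk∣ₚ
    field
      cofactor   : ℕ
      p∤cofactor : p ∤ cofactor
      ∣*cofactor : m ∣ n * cofactor

  ∣⇒∣ₚ : ∀ {m n} → m ∣ n → m ∣ₚ n
  ∣⇒∣ₚ {m} {n} m∣n = mk∣ₚ 1 p∤1 (subst (m ∣_) (sym (ℕ.*-identityʳ n)) m∣n)

  ∣ₚ-refl : ∀ {m} → m ∣ₚ m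
  ∣ₚ-refl = ∣⇒∣ₚ ∣-refl

  ∣ₚ-trans : ∀ {m n o} → m ∣ₚ n → n ∣ₚ o → m ∣ₚ o
  ∣ₚ-trans {m} {n} {o} (mk∣ₚ u p∤u m∣nu) (mk∣ₚ v p∤v n∣ov) = mk∣ₚ (v * u) (∤-* p∤v p∤u)
    (∣-trans m∣nu (subst (n * u ∣_) (ℕ.*-assoc o v u) (*-monoˡ-∣ u n∣ov)))

  *-pres-∣ₚ : ∀ {m n o r} → m ∣ₚ n → o ∣ₚ r → m * o ∣ₚ n * r
  *-pres-∣ₚ {m} {n} {o} {r} (mk∣ₚ u p∤u m∣nu) (mk∣ₚ v p∤v o∣rv) = mk∣ₚ (u * v) (∤-* p∤u p∤v)
    (subst (m * o ∣_) (ℕ.[m*n]*[o*p]≡[m*o]*[n*p] n u r v) (*-pres-∣ m∣nu o∣rv))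

  *-monoʳ-∣ₚ : ∀ {m n} o → m ∣ₚ n → o * m ∣ₚ o * n
  *-monoʳ-∣ₚ o = *-pres-∣ₚ (∣ₚ-refl {o})

  ^-pres-∣ₚ : ∀ {m n} o → m ∣ₚ n → m ^ o ∣ₚ n ^ o
  ^-pres-∣ₚ zero    m∣ₚn = ∣ₚ-refl
  ^-pres-∣ₚ (suc o) m∣ₚn = *-pres-∣ₚ m∣ₚn (^-pres-∣ₚ o m∣ₚn)

  ∤⇒∣ₚ1 : ∀ {u} → p ∤ u → u ∣ₚ 1
  ∤⇒∣ₚ1 {u} p∤u = mk∣ₚ u p∤u (subst (u ∣_) (sym (ℕ.*-identityˡ u)) ∣-refl)

  product-pres-∣ₚ : ∀ {A : Set} (f g : A → ℕ) {xs} → All (λ x → f x ∣ₚ g x) xs →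
                    product (map f xs) ∣ₚ product (map g xs)
  product-pres-∣ₚ f g []                = ∣ₚ-refl
  product-pres-∣ₚ f g (fx∣ₚgx ∷ fs∣ₚgs) = *-pres-∣ₚ fx∣ₚgx (product-pres-∣ₚ f g fs∣ₚgs)

  ∣ₚ-isPreorder : IsPreorder _≡_ _∣ₚ_
  ∣ₚ-isPreorder = record
    { isEquivalence = isEquivalence
    ; reflexive     = λ { refl → ∣ₚ-refl }
    ; trans         = ∣ₚ-trans
    }

  ∣ₚ-preorder : Preorder 0ℓ 0ℓ 0ℓ
  ∣ₚ-preorder = record { isPreorder = ∣ₚ-isPreorder }

  module ∣ₚ-Reasoning = Relation.Binary.Reasoning.Preorder ∣ₚ-preorder

  !-+-units : ∀ ρ M → (∀ k → k < ρ → p ∤ suc k + M) → (ρ + M) ! ∣ₚ M !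
  !-+-units zero    M units = ∣ₚ-refl
  !-+-units (suc ρ) M units = begin
    suc (ρ + M) * (ρ + M) !
      ≲⟨ *-pres-∣ₚ (∤⇒∣ₚ1 (units ρ ℕ.≤-refl)) (!-+-units ρ M (λ k k<ρ → units k (ℕ.m≤n⇒m≤1+n k<ρ))) ⟩
    1 * M !                  ≡⟨ ℕ.*-identityˡ (M !) ⟩
    M !                      ∎
    where open ∣ₚ-Reasoning

  [q*p]!∣ₚp^q*q! : ∀ q → (q * p) ! ∣ₚ p ^ q * q !
  [q*p]!∣ₚp^q*q! zero    = ∣ₚ-refl
  [q*p]!∣ₚp^q*q! (suc q) = begin
    (p + q * p) !                        ≡⟨ +-! p (q * p) ⟩
    (p + q * p) * ((p ∸ 1) + q * p) !    ≲⟨ *-monoʳ-∣ₚ (p + q * p) (!-+-units (p ∸ 1) (q * p) units) ⟩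
    (p + q * p) * (q * p) !              ≲⟨ *-monoʳ-∣ₚ (p + q * p) ([q*p]!∣ₚp^q*q! q) ⟩
    (p + q * p) * (p ^ q * q !)          ≡⟨ rearrange p q (p ^ q) (q !) ⟩
    p ^ suc q * suc q !                  ∎
    where
    open ∣ₚ-Reasoning
    units : ∀ k → k < p ∸ 1 → p ∤ suc k + q * p
    units k k<p-1 = ∤-+-multiple q (subst (suc k <_) (ℕ.m+[n∸m]≡n (ℕ.<⇒≤ 1<p)) (s≤s k<p-1))
    rearrange : ∀ p q x f → (p + q * p) * (x * f) ≡ p * x * (f + q * f)
    rearrange = solve-∀

  [ρ+q*p]!∣ₚp^q*q! : ∀ {ρ} q → ρ < p → (ρ + q * p) ! ∣ₚ p ^ q * q !
  [ρ+q*p]!∣ₚp^q*q! {ρ} q ρ<p =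
    ∣ₚ-trans (!-+-units ρ (q * p) (λ k k<ρ → ∤-+-multiple q (ℕ.≤-trans (s≤s k<ρ) ρ<p))) ([q*p]!∣ₚp^q*q! q)

  coprimeFactorial-∤ : ∀ {N} → p ∣ N → ∀ x → p ∤ coprimeFactorial N x
  coprimeFactorial-∤ p∣N zero = p∤1
  coprimeFactorial-∤ {N} p∣N (suc x) = ∤-* (coprimeFactorial-∤ p∣N x) (last (coprime? (suc x) N))
    where
    last : (c : Dec (Coprime (suc x) N)) → p ∤ (if does c then suc x else 1)
    last (yes 1+x⊥N) p∣1+x = ℕ.<⇒≢ 1<p (sym (1+x⊥N (p∣1+x , p∣N)))
    last (no _)            = p∤1

  coprimeTo-*p : ∀ M k → coprimeTo (M * p) k ≡ coprimeTo M k ∧ not (does (p ∣? k))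
  coprimeTo-*p M k = does-⇔ (mk⇔ to from) (coprime? k (M * p)) (coprime? k M ×-dec ¬? (p ∣? k))
    where
    to : Coprime k (M * p) → Coprime k M × p ∤ k
    to k⊥Mp = (λ (d∣k , d∣M) → k⊥Mp (d∣k , ∣m⇒∣m*n p d∣M))
            , (λ p∣k → ℕ.<⇒≢ 1<p (sym (k⊥Mp (p∣k , n∣m*n M))))
    -- a common divisor d of k and M p is prime to M, hence divides p, and d ≢ p since p ∤ k
    from : Coprime k M × p ∤ k → Coprime k (M * p)
    from (k⊥M , p∤k) {d} (d∣k , d∣Mp) with prime⇒irreducible p-prime d∣p
      where d∣p = coprime-divisor (λ (e∣d , e∣M) → k⊥M (∣-trans e∣d d∣k , e∣M)) d∣Mp
    ... | inj₁ d≡1 = d≡1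
    ... | inj₂ refl = contradiction d∣k p∤k

  φ-*p : ∀ M → φ (M * p) + count (λ j → coprimeTo M (j * p)) M ≡ p * φ M
  φ-*p M = begin
    φ (M * p) + count (λ j → coprimeTo M (j * p)) M
      ≡⟨ cong₂ _+_ (trans (φ≡count-coprimeTo (M * p)) (count-cong (coprimeTo-*p M) (M * p)))
                   (sym (count-∧-multiples (coprimeTo M) p M)) ⟩
    #prime-to-p + #multiples-of-p   ≡⟨ ℕ.+-comm #prime-to-p #multiples-of-p ⟩
    #multiples-of-p + #prime-to-p   ≡⟨ count-∧-split (coprimeTo M) (does ∘ (p ∣?_)) (M * p) ⟨
    count (coprimeTo M) (M * p)     ≡⟨ cong (count (coprimeTo M)) (ℕ.*-comm M p) ⟩
    count (coprimeTo M) (p * M)     ≡⟨ count-coprimeTo-multiple M p ⟩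
    p * φ M                         ∎
    where
    open ≡-Reasoning
    #multiples-of-p #prime-to-p : ℕ
    #multiples-of-p = count (λ k → coprimeTo M k ∧ does (p ∣? k)) (M * p)
    #prime-to-p     = count (λ k → coprimeTo M k ∧ not (does (p ∣? k))) (M * p)

  φ-*p-coprime : ∀ {M} → p ∤ M → φ (M * p) ≡ (p ∸ 1) * φ M
  φ-*p-coprime {M} p∤M = ℕ.+-cancelʳ-≡ (φ M) _ _ (begin
    φ (M * p) + φ M
      ≡⟨ cong (φ (M * p) +_) (trans (φ≡count-coprimeTo M) (count-cong (λ j → sym (coprimeTo-*-coprime j p⊥M)) M)) ⟩
    φ (M * p) + count (λ j → coprimeTo M (j * p)) M  ≡⟨ φ-*p M ⟩
    p * φ M                                          ≡⟨ cong (_* φ M) (ℕ.m∸n+n≡m (ℕ.<⇒≤ 1<p)) ⟨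
    (p ∸ 1 + 1) * φ M                                ≡⟨ ℕ.*-distribʳ-+ (φ M) (p ∸ 1) 1 ⟩
    (p ∸ 1) * φ M + 1 * φ M                          ≡⟨ cong ((p ∸ 1) * φ M +_) (ℕ.*-identityˡ (φ M)) ⟩
    (p ∸ 1) * φ M + φ M                              ∎)
    where
    open ≡-Reasoning
    p⊥M = ∤⇒coprime p∤M

  φ-*p-multiple : ∀ {M} → p ∣ M → φ (M * p) ≡ p * φ M
  φ-*p-multiple {M} p∣M = trans (sym (ℕ.+-identityʳ (φ (M * p))))
    (trans (cong (φ (M * p) +_) (sym (count-false _ M multiples-not-coprime))) (φ-*p M))
    where
    multiples-not-coprime : ∀ j → j < M → coprimeTo M (suc j * p) ≡ false
    multiples-not-coprime j _ = dec-false (coprime? (suc j * p) M) (λ jp⊥M → ℕ.<⇒≢ 1<p (sym (jp⊥M (n∣m*n (suc j) , p∣M))))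

  p∸1∣φ : ∀ N .{{_ : NonZero N}} → p ∣ N → (p ∸ 1) ∣ φ N
  p∸1∣φ N {{N≢0}} = <-rec (λ N → .(NonZero N) → p ∣ N → (p ∸ 1) ∣ φ N) step N N≢0
    where
    step : ∀ N → (∀ {M} → M < N → .(NonZero M) → p ∣ M → (p ∸ 1) ∣ φ M) → .(NonZero N) → p ∣ N → (p ∸ 1) ∣ φ N
    step N rec N≢0 (divides M refl) with p ∣? M
    ... | yes p∣M = subst ((p ∸ 1) ∣_) (sym (φ-*p-multiple p∣M))
                      (∣n⇒∣m*n p (rec (ℕ.m<m*n M p {{M≢0}} 1<p) M≢0 p∣M))
      where M≢0 = ℕ.m*n≢0⇒m≢0 M {{N≢0}}
    ... | no p∤M = subst ((p ∸ 1) ∣_) (sym (φ-*p-coprime p∤M)) (m∣m*n (φ M))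

  p^[φ/[p∸1]]∣primePowers : ∀ {N} .{{_ : NonZero N}} → p ∣ N → p ^ divℕ (φ N) (p ∸ 1) ∣ primePowers N
  p^[φ/[p∸1]]∣primePowers {N} p∣N = ∈⇒∣product (∈-map⁺ (λ q → q ^ divℕ (φ N) (q ∸ 1)) p∈primeDivisors)
    where
    p∈range1 : p ∈ range1 N
    p∈range1 = subst (_∈ range1 N) (ℕ.suc-pred p)
                 (∈-map⁺ suc (∈-upTo⁺ (subst (_≤ N) (sym (ℕ.suc-pred p)) (∣⇒≤ p∣N))))
    p∈primeDivisors : p ∈ primeDivisors N
    p∈primeDivisors = ∈-filter⁺ (λ q → prime? q ×-dec (q ∣? N)) p∈range1 (p-prime , p∣N)

  q≤ρ+q*p : ∀ ρ q → q ≤ ρ + q * p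
  q≤ρ+q*p ρ q = ℕ.≤-trans (ℕ.m≤m*n q p) (ℕ.m≤n+m (q * p) ρ)

  p^[qφ]*reducedNumerator-∣-coprime : ∀ {N} ρ q → p ∤ N →
    (p ^ q) ^ φ N * reducedNumerator N q ∣ reducedNumerator N (ρ + q * p)
  p^[qφ]*reducedNumerator-∣-coprime {N} ρ q p∤N = begin
    (p ^ q) ^ φ N * (D ^ q * coprimeFactorial N (q * N))   ≡⟨ ℕ*.x∙yz≈y∙xz ((p ^ q) ^ φ N) (D ^ q) _ ⟩
    D ^ q * ((p ^ q) ^ φ N * coprimeFactorial N (q * N))   ≡⟨ cong (λ e → D ^ q * (e * coprimeFactorial N (q * N))) p^[q*φ] ⟩
    D ^ q * (p ^ count (coprimeTo N) (q * N) * coprimeFactorial N (q * N))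
      ∣⟨ *-pres-∣ (^-∣-^ D (q≤ρ+q*p ρ q)) (coprimeFactorial-lift p (∤⇒coprime p∤N) (q * N)) ⟩
    D ^ a * coprimeFactorial N (q * N * p)
      ∣⟨ *-monoʳ-∣ (D ^ a) (subst (coprimeFactorial N (q * N * p) ∣_) (cong (coprimeFactorial N) aN)
                                  (coprimeFactorial-∣-+ N (q * N * p) (ρ * N))) ⟩
    D ^ a * coprimeFactorial N (a * N) ∎
    where
    open ∣-Reasoning
    D = primePowers N
    a = ρ + q * p
    p^[q*φ] : (p ^ q) ^ φ N ≡ p ^ count (coprimeTo N) (q * N)
    p^[q*φ] = trans (ℕ.^-*-assoc p q (φ N)) (cong (p ^_) (sym (count-coprimeTo-multiple N q)))
    aN : q * N * p + ρ * N ≡ (ρ + q * p) * N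
    aN = rearrange q N p ρ
      where
      rearrange : ∀ q N p ρ → q * N * p + ρ * N ≡ (ρ + q * p) * N
      rearrange = solve-∀

  p^[qφ]*reducedNumerator-∣ₚ-divisible : ∀ {N} .{{_ : NonZero N}} ρ q → p ∣ N →
    (p ^ q) ^ φ N * reducedNumerator N q ∣ₚ reducedNumerator N (ρ + q * p)
  p^[qφ]*reducedNumerator-∣ₚ-divisible {N} ρ q p∣N = begin
    (p ^ q) ^ φ N * (D ^ q * coprimeFactorial N (q * N))
      ≲⟨ *-monoʳ-∣ₚ ((p ^ q) ^ φ N) (*-monoʳ-∣ₚ (D ^ q) (∤⇒∣ₚ1 (coprimeFactorial-∤ p∣N (q * N)))) ⟩
    (p ^ q) ^ φ N * (D ^ q * 1)      ≡⟨ cong ((p ^ q) ^ φ N *_) (ℕ.*-identityʳ (D ^ q)) ⟩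
    (p ^ q) ^ φ N * D ^ q            ≲⟨ ∣⇒∣ₚ (∣-trans p^[q*φ]*D^q∣D^a (m∣m*n _)) ⟩
    D ^ a * coprimeFactorial N (a * N) ∎
    where
    open ∣ₚ-Reasoning
    D = primePowers N
    a = ρ + q * p
    e = divℕ (φ N) (p ∸ 1)
    φ≡e*[p∸1] : φ N ≡ e * (p ∸ 1)
    φ≡e*[p∸1] = sym (divℕ-* (φ N) (p ∸ 1) (p∸1∣φ N p∣N))
    p^[q*φ] : (p ^ q) ^ φ N ≡ (p ^ e) ^ (q * (p ∸ 1))
    p^[q*φ] = begin-equality
      (p ^ q) ^ φ N                ≡⟨ ℕ.^-*-assoc p q (φ N) ⟩
      p ^ (q * φ N)                ≡⟨ cong (λ f → p ^ (q * f)) φ≡e*[p∸1] ⟩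
      p ^ (q * (e * (p ∸ 1)))      ≡⟨ cong (p ^_) (ℕ*.x∙yz≈y∙xz q e (p ∸ 1)) ⟩
      p ^ (e * (q * (p ∸ 1)))      ≡⟨ ℕ.^-*-assoc p e (q * (p ∸ 1)) ⟨
      (p ^ e) ^ (q * (p ∸ 1))      ∎
    q*[p∸1]+q≡q*p : q * (p ∸ 1) + q ≡ q * p
    q*[p∸1]+q≡q*p = begin-equality
      q * (p ∸ 1) + q    ≡⟨ ℕ.+-comm (q * (p ∸ 1)) q ⟩
      q + q * (p ∸ 1)    ≡⟨ ℕ.*-suc q (p ∸ 1) ⟨
      q * (1 + (p ∸ 1))  ≡⟨ cong (q *_) (ℕ.m+[n∸m]≡n (ℕ.<⇒≤ 1<p)) ⟩
      q * p              ∎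
    p^[q*φ]*D^q∣D^a : (p ^ q) ^ φ N * D ^ q ∣ D ^ a
    p^[q*φ]*D^q∣D^a = ∣-trans
      (subst₂ (λ x y → x * D ^ q ∣ y) (sym p^[q*φ]) (sym (ℕ.^-distribˡ-+-* D (q * (p ∸ 1)) q))
        (*-monoˡ-∣ (D ^ q) (^-pres-∣ (q * (p ∸ 1)) (p^[φ/[p∸1]]∣primePowers p∣N))))
      (^-∣-^ D (subst (_≤ a) (sym q*[p∸1]+q≡q*p) (ℕ.m≤n+m (q * p) ρ)))

  p^[qφ]*reducedNumerator-∣ₚ : ∀ N .{{_ : NonZero N}} ρ q →
    (p ^ q) ^ φ N * reducedNumerator N q ∣ₚ reducedNumerator N (ρ + q * p)
  p^[qφ]*reducedNumerator-∣ₚ N ρ q with p ∣? N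
  ... | yes p∣N = p^[qφ]*reducedNumerator-∣ₚ-divisible ρ q p∣N
  ... | no  p∤N = ∣⇒∣ₚ (p^[qφ]*reducedNumerator-∣-coprime ρ q p∤N)

  reducedNumerator-∣ₚ : ∀ N .{{_ : NonZero N}} {ρ} q → ρ < p →
    ((ρ + q * p) !) ^ φ N * reducedNumerator N q ∣ₚ reducedNumerator N (ρ + q * p) * (q !) ^ φ N
  reducedNumerator-∣ₚ N {ρ} q ρ<p = begin
    ((ρ + q * p) !) ^ φ N * R q          ≲⟨ *-pres-∣ₚ (^-pres-∣ₚ (φ N) ([ρ+q*p]!∣ₚp^q*q! q ρ<p)) (∣ₚ-refl {R q}) ⟩
    (p ^ q * q !) ^ φ N * R q            ≡⟨ cong (_* R q) (*-^-distrib (p ^ q) (q !) (φ N)) ⟩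
    (p ^ q) ^ φ N * (q !) ^ φ N * R q    ≡⟨ ℕ*.xy∙z≈y∙xz ((p ^ q) ^ φ N) ((q !) ^ φ N) (R q) ⟩
    (q !) ^ φ N * ((p ^ q) ^ φ N * R q)  ≲⟨ *-monoʳ-∣ₚ ((q !) ^ φ N) (p^[qφ]*reducedNumerator-∣ₚ N ρ q) ⟩
    (q !) ^ φ N * R (ρ + q * p)          ≡⟨ ℕ.*-comm ((q !) ^ φ N) (R (ρ + q * p)) ⟩
    R (ρ + q * p) * (q !) ^ φ N          ∎
    where
    open ∣ₚ-Reasoning
    R = reducedNumerator N

  B-ratio-∣ₚ : ∀ N .{{_ : NonZero N}} {ρ} q → ρ < p →
    B-denominator N (ρ + q * p) * B-numerator N q ∣ₚ B-numerator N (ρ + q * p) * B-denominator N q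
  B-ratio-∣ₚ N {ρ} q ρ<p = begin
    B-denominator N a * B-numerator N q      ≡⟨ cong₂ _*_ (B-denominator-split N a) (B-numerator-split N q) ⟩
    K a * (a !) ^ φ N * (K q * R q)            ≡⟨ ℕ*.interchange (K a) ((a !) ^ φ N) (K q) (R q) ⟩
    K a * K q * ((a !) ^ φ N * R q)            ≲⟨ *-monoʳ-∣ₚ (K a * K q) (reducedNumerator-∣ₚ N q ρ<p) ⟩
    K a * K q * (R a * (q !) ^ φ N)            ≡⟨ ℕ*.interchange (K a) (R a) (K q) ((q !) ^ φ N) ⟨
    K a * R a * (K q * (q !) ^ φ N)            ≡⟨ cong₂ _*_ (B-numerator-split N a) (B-denominator-split N q) ⟨
    B-numerator N a * B-denominator N q      ∎
    where
    open ∣ₚ-Reasoning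
    a = ρ + q * p
    K R : ℕ → ℕ
    K n = (N ^ φ N) ^ n
    R = reducedNumerator N

  -- x ÷ y ∈ℤ₍ₚ₎: x / y = c / d for some c and some d prime to p, stated without dividing by y.
  _÷_∈ℤ₍ₚ₎ : ℚ → ℚ → Set
  x ÷ y ∈ℤ₍ₚ₎ = ∃[ c ] ∃[ d ] (p ∤ d × x ℚ.* ℕ→ℚ d ≡ y ℚ.* ℕ→ℚ c)

  ÷∈ℤ₍ₚ₎-refl : ∀ x → x ÷ x ∈ℤ₍ₚ₎
  ÷∈ℤ₍ₚ₎-refl x = 1 , 1 , p∤1 , refl

  ÷∈ℤ₍ₚ₎-trans : ∀ {x y z} → x ÷ y ∈ℤ₍ₚ₎ → y ÷ z ∈ℤ₍ₚ₎ → x ÷ z ∈ℤ₍ₚ₎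
  ÷∈ℤ₍ₚ₎-trans {x} {y} {z} (c , d , p∤d , xd≡yc) (c′ , d′ , p∤d′ , yd′≡zc′) =
    c′ * c , d * d′ , ∤-* p∤d p∤d′ , (begin
      x ℚ.* ℕ→ℚ (d * d′)               ≡⟨ cong (x ℚ.*_) (ℕ→ℚ-* d d′) ⟩
      x ℚ.* (ℕ→ℚ d ℚ.* ℕ→ℚ d′)         ≡⟨ ℚ.*-assoc x (ℕ→ℚ d) (ℕ→ℚ d′) ⟨
      x ℚ.* ℕ→ℚ d ℚ.* ℕ→ℚ d′           ≡⟨ cong (ℚ._* ℕ→ℚ d′) xd≡yc ⟩
      y ℚ.* ℕ→ℚ c ℚ.* ℕ→ℚ d′           ≡⟨ ℚ*.xy∙z≈xz∙y y (ℕ→ℚ c) (ℕ→ℚ d′) ⟩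
      y ℚ.* ℕ→ℚ d′ ℚ.* ℕ→ℚ c           ≡⟨ cong (ℚ._* ℕ→ℚ c) yd′≡zc′ ⟩
      z ℚ.* ℕ→ℚ c′ ℚ.* ℕ→ℚ c           ≡⟨ ℚ.*-assoc z (ℕ→ℚ c′) (ℕ→ℚ c) ⟩
      z ℚ.* (ℕ→ℚ c′ ℚ.* ℕ→ℚ c)         ≡⟨ cong (z ℚ.*_) (ℕ→ℚ-* c′ c) ⟨
      z ℚ.* ℕ→ℚ (c′ * c)               ∎)
    where open ≡-Reasoning

  ∣ₚ⇒÷∈ℤ₍ₚ₎ : ∀ {x y} {X Y X′ Y′} .{{_ : NonZero Y}} .{{_ : NonZero Y′}} →
    x ℚ.* ℕ→ℚ Y ≡ ℕ→ℚ X → y ℚ.* ℕ→ℚ Y′ ≡ ℕ→ℚ X′ → Y * X′ ∣ₚ X * Y′ → x ÷ y ∈ℤ₍ₚ₎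
  ∣ₚ⇒÷∈ℤ₍ₚ₎ {x} {y} {X} {Y} {X′} {Y′} xY≡X yY′≡X′ (mk∣ₚ d p∤d (divides c XY′d≡cYX′)) =
    c , d , p∤d , ℕ→ℚ-*-cancelʳ (Y * Y′) {{ℕ.m*n≢0 Y Y′}} (begin
      x ℚ.* ℕ→ℚ d ℚ.* ℕ→ℚ (Y * Y′)                 ≡⟨ cong (x ℚ.* ℕ→ℚ d ℚ.*_) (ℕ→ℚ-* Y Y′) ⟩
      x ℚ.* ℕ→ℚ d ℚ.* (ℕ→ℚ Y ℚ.* ℕ→ℚ Y′)           ≡⟨ rearrange x (ℕ→ℚ d) (ℕ→ℚ Y) (ℕ→ℚ Y′) ⟩
      x ℚ.* ℕ→ℚ Y ℚ.* (ℕ→ℚ Y′ ℚ.* ℕ→ℚ d)           ≡⟨ cong₂ ℚ._*_ xY≡X (sym (ℕ→ℚ-* Y′ d)) ⟩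
      ℕ→ℚ X ℚ.* ℕ→ℚ (Y′ * d)                       ≡⟨ ℕ→ℚ-* X (Y′ * d) ⟨
      ℕ→ℚ (X * (Y′ * d))                           ≡⟨ cong ℕ→ℚ (trans (sym (ℕ.*-assoc X Y′ d)) XY′d≡cYX′) ⟩
      ℕ→ℚ (c * (Y * X′))                           ≡⟨ trans (ℕ→ℚ-* c (Y * X′)) (cong (ℕ→ℚ c ℚ.*_) (ℕ→ℚ-* Y X′)) ⟩
      ℕ→ℚ c ℚ.* (ℕ→ℚ Y ℚ.* ℕ→ℚ X′)                 ≡⟨ cong (λ z → ℕ→ℚ c ℚ.* (ℕ→ℚ Y ℚ.* z)) yY′≡X′ ⟨
      ℕ→ℚ c ℚ.* (ℕ→ℚ Y ℚ.* (y ℚ.* ℕ→ℚ Y′))         ≡⟨ rearrange′ (ℕ→ℚ c) (ℕ→ℚ Y) y (ℕ→ℚ Y′) ⟩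
      y ℚ.* ℕ→ℚ c ℚ.* (ℕ→ℚ Y ℚ.* ℕ→ℚ Y′)           ≡⟨ cong (y ℚ.* ℕ→ℚ c ℚ.*_) (ℕ→ℚ-* Y Y′) ⟨
      y ℚ.* ℕ→ℚ c ℚ.* ℕ→ℚ (Y * Y′)                 ∎)
    where
    open ≡-Reasoning
    rearrange : ∀ x d Y Y′ → x ℚ.* d ℚ.* (Y ℚ.* Y′) ≡ x ℚ.* Y ℚ.* (Y′ ℚ.* d)
    rearrange = solve 4 (λ x d Y Y′ → x :* d :* (Y :* Y′) := x :* Y :* (Y′ :* d)) refl
    rearrange′ : ∀ c Y y Y′ → c ℚ.* (Y ℚ.* (y ℚ.* Y′)) ≡ y ℚ.* c ℚ.* (Y ℚ.* Y′)
    rearrange′ = solve 4 (λ c Y y Y′ → c :* (Y :* (y :* Y′)) := y :* c :* (Y :* Y′)) refl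

  BB-ratio-step : ∀ {Ns} → All NonZero Ns → ∀ {ρ} q → ρ < p → BB Ns (ρ + q * p) ÷ BB Ns q ∈ℤ₍ₚ₎
  BB-ratio-step {Ns} Ns≢0 {ρ} q ρ<p =
    ∣ₚ⇒÷∈ℤ₍ₚ₎ {BB Ns a} {BB Ns q}
      {BB-numerator Ns a} {BB-denominator Ns a} {BB-numerator Ns q} {BB-denominator Ns q}
      {{BB-denominator≢0 Ns≢0 a}} {{BB-denominator≢0 Ns≢0 q}}
      (BB-*-denominator Ns≢0 a) (BB-*-denominator Ns≢0 q)
      (subst₂ _∣ₚ_ (product-map-* (λ N → B-denominator N a) (λ N → B-numerator N q) Ns)
                   (product-map-* (λ N → B-numerator N a) (λ N → B-denominator N q) Ns)
        (product-pres-∣ₚ _ _ (All.map (λ N≢0 → B-ratio-∣ₚ _ {{N≢0}} q ρ<p) Ns≢0)))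
    where a = ρ + q * p

  -- Peel off the lowest base-p digit ρ of w: w + m pʳ⁺¹ = ρ + (w / p + m pʳ) p.
  BB-ratio : ∀ {Ns} → All NonZero Ns → ∀ r m w → w < p ^ r → BB Ns (w + m * p ^ r) ÷ BB Ns m ∈ℤ₍ₚ₎
  BB-ratio {Ns} Ns≢0 zero m zero _ =
    subst (λ n → BB Ns n ÷ BB Ns m ∈ℤ₍ₚ₎) (sym (ℕ.*-identityʳ m)) (÷∈ℤ₍ₚ₎-refl (BB Ns m))
  BB-ratio Ns≢0 zero m (suc w) (s≤s ())
  BB-ratio {Ns} Ns≢0 (suc r) m w w<p^[1+r] =
    ÷∈ℤ₍ₚ₎-trans {BB Ns (w + m * p ^ suc r)} {BB Ns (w / p + m * p ^ r)} {BB Ns m}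
    (subst (λ n → BB Ns n ÷ BB Ns (w / p + m * p ^ r) ∈ℤ₍ₚ₎) (sym digits)
      (BB-ratio-step Ns≢0 (w / p + m * p ^ r) (m%n<n w p)))
    (BB-ratio Ns≢0 r m (w / p) (m<n*o⇒m/o<n (subst (w <_) (ℕ.*-comm p (p ^ r)) w<p^[1+r])))
    where
    digits : w + m * p ^ suc r ≡ w % p + (w / p + m * p ^ r) * p
    digits = trans (cong (_+ m * p ^ suc r) (m≡m%n+[m/n]*n w p)) (rearrange (w % p) (w / p) m p (p ^ r))
      where
      rearrange : ∀ ρ w′ m p x → ρ + w′ * p + m * (p * x) ≡ ρ + (w′ + m * x) * p
      rearrange = solve-∀

lemma29 : (p : ℕ) → Prime p → (Ns : List ℕ) → All NonZero Ns →
    (m r w : ℕ) → w < p ^ r →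
    ∃[ c ] ∃[ d ] ((¬ (p ∣ d)) ×
      (BB Ns (w + m * p ^ r) ℚ.* ℕ→ℚ d ≡ BB Ns m ℚ.* ℤ→ℚ c))
lemma29 p p-prime Ns Ns≢0 m r w w<p^r =
  let c , d , p∤d , eq = BB-ratio p p-prime Ns≢0 r m w w<p^r in ℤ.+ c , d , p∤d , eq
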